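{- Let $G=(V,E)$ be a $3$-leaf power. Then every cycle $C$ of $G$ of length at least $5$ (not necessarily induced) contains four distinct vertices $a,b,c,d$, appearing in this order along $C$, such that $\{a,b\}$ and $\{c,d\}$ are edges of $C$ and $\{a,d\}\in E$, $\{a,c\}\in E$ and $\{b,d\}\in E$.
   Context: Graphs are finite, undirected and loopless. A graph $G=(V,E)$ is a $3$-leaf power if there exists a tree $T$ whose set of leaves is $V$ such that for distinct $u,v\in V$, $\{u,v\}\in E$ iff the distance between $u$ and $v$ in $T$ is at most $3$. -}

module Defs where

open import Data.Nat using (ℕ; zero; suc; _≤_)
open import Data.Fin using (Fin; zero; suc; inject₁; fromℕ)
open import Data.Product using (Σ; ∃; _×_; _,_)
open import Data.Sum using (_⊎_)
open import Relation.Nullary using (¬_)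
open import Relation.Binary.PropositionalEquality using (_≡_; _≢_)
open import Function.Bundles using (_⇔_)

record Graph (n : ℕ) : Set₁ where
  field
    Adj    : Fin n → Fin n → Set
    sym    : ∀ {u v} → Adj u v → Adj v u
    irrefl : ∀ {u} → ¬ Adj u u
open Graph public

data Walk {n : ℕ} (G : Graph n) : Fin n → Fin n → ℕ → Set where
  here : ∀ {x} → Walk G x x zero
  step : ∀ {x y z ℓ} → Adj G x y → Walk G y z ℓ → Walk G x z (suc ℓ)

DistLe : {n : ℕ} → Graph n → Fin n → Fin n → ℕ → Set
DistLe G x y k = ∃ λ ℓ → ℓ ≤ k × Walk G x y ℓ

Connected : {n : ℕ} → Graph n → Set
Connected G = ∀ x y → ∃ λ ℓ → Walk G x y ℓ

-- A cycle of length (suc m) in G: distinct vertices C 0, …, C m with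
-- C i ~ C (i+1) for i < m and C m ~ C 0.
record Cycle {n : ℕ} (G : Graph n) (m : ℕ) : Set where
  field
    vtx      : Fin (suc m) → Fin n
    distinct : ∀ i j → vtx i ≡ vtx j → i ≡ j
    path     : ∀ (i : Fin m) → Adj G (vtx (inject₁ i)) (vtx (suc i))
    closing  : Adj G (vtx (fromℕ m)) (vtx zero)
open Cycle public

CycleStep : {n : ℕ} {G : Graph n} {m : ℕ} → Cycle G m → Fin n → Fin n → Set
CycleStep {m = m} C x y =
  (∃ λ (i : Fin m) → x ≡ vtx C (inject₁ i) × y ≡ vtx C (suc i))
  ⊎ (x ≡ vtx C (fromℕ m) × y ≡ vtx C zero)

-- A tree: connected graph with no cycle (cycles have length ≥ 3).
IsTree : {t : ℕ} → Graph t → Set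
IsTree T = Connected T × (∀ m → 2 ≤ m → ¬ Cycle T m)

IsLeaf : {t : ℕ} → Graph t → Fin t → Set
IsLeaf T x = ∃ λ u → Adj T x u × (∀ w → Adj T x w → w ≡ u)

Is3LeafPower : {n : ℕ} → Graph n → Set₁
Is3LeafPower {n} G =
  Σ ℕ λ t → Σ (Graph t) λ T → Σ (Fin n → Fin t) λ ι →
    IsTree T
    × (∀ u v → ι u ≡ ι v → u ≡ v)
    × (∀ x → IsLeaf T x ⇔ (∃ λ v → ι v ≡ x))
    × (∀ u v → u ≢ v → (Adj G u v ⇔ DistLe T (ι u) (ι v) 3))

-- Every leaf u of the tree hangs from a unique inner vertex p(u), and two distinct leaves
-- are adjacent in G exactly when p(u) and p(v) are equal or adjacent.  Hence p maps the
-- edges of a cycle C of G to edges or loops of the tree; as a tree has no cycles, p cannot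
-- be injective on C.  Walking once around C, two vertices x and y with p(x) = p(y) split C
-- into two arcs, one of which has at least three edges since C has at least five.  With
-- x = a, y = d at the ends of that arc, b the neighbour of a and c the neighbour of d on
-- it, p(c) and p(b) are equal or adjacent to p(a) = p(d), which gives the three chords.
module Submission where

open import Defs
open import Data.Nat using (ℕ; zero; suc; _≤_; _<_; _+_; _∸_; _*_; _%_; z≤n; s≤s; s≤s⁻¹; NonZero; >-nonZero)
open import Data.Nat.Properties
open import Data.Nat.DivMod using (_mod_; _/_; m≡m%n+[m/n]*n; m%n<n; m<n⇒m%n≡m; n%n≡0; [m+n]%n≡m%n; [m+kn]%n≡m%n; %-congˡ)
open import Data.Nat.Divisibility using (_∣_; divides; ∣⇒≤)
open import Data.Fin as Fin using (Fin; zero; suc; inject₁; fromℕ; toℕ; fromℕ<)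
open import Data.Fin.Properties using (toℕ-injective; toℕ-fromℕ<; toℕ-inject₁; toℕ-fromℕ; toℕ<n; any?)
  renaming (_≟_ to _≟ᶠ_; <-cmp to <-cmpᶠ)
open import Data.Product using (∃; ∃₂; _×_; _,_; proj₁; proj₂)
open import Data.Sum using (_⊎_; inj₁; inj₂; [_,_])
open import Data.Empty using (⊥-elim)
open import Relation.Nullary using (¬_; yes; no)
open import Relation.Nullary.Decidable using (_×-dec_)
open import Relation.Binary.Definitions using (DecidableEquality; tri<; tri≈; tri>)
open import Relation.Binary.PropositionalEquality
  using (_≡_; _≢_; refl; cong; cong₂; subst; trans; module ≡-Reasoning) renaming (sym to ≡-sym)
open import Function.Bundles using (_⇔_; Equivalence)

toℕ-mod : ∀ k d .{{_ : NonZero d}} → toℕ (k mod d) ≡ k % d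
toℕ-mod k d = toℕ-fromℕ< (m%n<n k d)

%-injective-window : ∀ {k l} d .{{_ : NonZero d}} → k < l → l < k + d → k % d ≢ l % d
%-injective-window {k} {l} d k<l l<k+d k%d≡l%d = <⇒≱ l∸k<d (∣⇒≤ d∣l∸k)
  where
  open ≡-Reasoning
  instance
    l∸k-nonZero : NonZero (l ∸ k)
    l∸k-nonZero = >-nonZero (m<n⇒0<n∸m k<l)
  l∸k<d : l ∸ k < d
  l∸k<d = m<n+o⇒m∸n<o l k l<k+d
  d∣l∸k : d ∣ l ∸ k
  d∣l∸k = divides (l / d ∸ k / d) (begin
    l ∸ k                                     ≡⟨ cong₂ _∸_ (m≡m%n+[m/n]*n l d) (m≡m%n+[m/n]*n k d) ⟩
    (l % d + l / d * d) ∸ (k % d + k / d * d) ≡⟨ cong (λ r → (l % d + l / d * d) ∸ (r + k / d * d)) k%d≡l%d ⟩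
    (l % d + l / d * d) ∸ (l % d + k / d * d) ≡⟨ [m+n]∸[m+o]≡n∸o (l % d) (l / d * d) (k / d * d) ⟩
    l / d * d ∸ k / d * d                     ≡⟨ *-distribʳ-∸ d (l / d) (k / d) ⟨
    (l / d ∸ k / d) * d                       ∎)

suc-mod : ∀ m k → (∃ λ (i : Fin m) → k mod suc m ≡ inject₁ i × suc k mod suc m ≡ suc i)
                ⊎ (k mod suc m ≡ fromℕ m × suc k mod suc m ≡ zero)
suc-mod m k = from-remainder (m<1+n⇒m<n∨m≡n (m%n<n k N))
  where
  N = suc m
  suc-k%N : toℕ (suc k mod N) ≡ suc (k % N) % N
  suc-k%N = trans (toℕ-mod (suc k) N)
    (trans (%-congˡ {o = N} (cong suc (m≡m%n+[m/n]*n k N))) ([m+kn]%n≡m%n (suc (k % N)) (k / N) N))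
  from-remainder : k % N < m ⊎ k % N ≡ m →
    (∃ λ (i : Fin m) → k mod N ≡ inject₁ i × suc k mod N ≡ suc i) ⊎ (k mod N ≡ fromℕ m × suc k mod N ≡ zero)
  from-remainder (inj₁ r<m) = inj₁ (fromℕ< r<m
    , toℕ-injective (trans (toℕ-mod k N) (≡-sym (trans (toℕ-inject₁ (fromℕ< r<m)) (toℕ-fromℕ< r<m))))
    , toℕ-injective (trans suc-k%N (trans (m<n⇒m%n≡m (s≤s r<m)) (cong suc (≡-sym (toℕ-fromℕ< r<m))))))
  from-remainder (inj₂ r≡m) = inj₂
    ( toℕ-injective (trans (toℕ-mod k N) (trans r≡m (≡-sym (toℕ-fromℕ m))))
    , toℕ-injective (trans suc-k%N (trans (%-congˡ {o = N} (cong suc r≡m)) (n%n≡0 N))))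

injective⊎collision : ∀ {k} {A : Set} → DecidableEquality A → (f : Fin k → A) →
  (∀ i j → f i ≡ f j → i ≡ j) ⊎ ∃₂ λ i j → i Fin.< j × f i ≡ f j
injective⊎collision _≟_ f
  with any? (λ i → any? (λ j → (toℕ i <? toℕ j) ×-dec (f i ≟ f j)))
... | yes (i , j , i<j , fi≡fj) = inj₂ (i , j , i<j , fi≡fj)
... | no no-collision = inj₁ injective
  where
  injective : ∀ i j → f i ≡ f j → i ≡ j
  injective i j fi≡fj with <-cmpᶠ i j
  ... | tri< i<j _ _ = ⊥-elim (no-collision (i , j , i<j , fi≡fj))
  ... | tri≈ _ i≡j _ = i≡j
  ... | tri> _ _ j<i = ⊥-elim (no-collision (j , i , j<i , ≡-sym fi≡fj))

module _ {t : ℕ} (T : Graph t) where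

  Near : Fin t → Fin t → Set
  Near x y = x ≡ y ⊎ Adj T x y

  near-sym : ∀ {x y} → Near x y → Near y x
  near-sym (inj₁ x≡y) = inj₁ (≡-sym x≡y)
  near-sym (inj₂ x~y) = inj₂ (sym T x~y)

  isolated-edge-walk : ∀ {x y} → (∀ w → Adj T x w → w ≡ y) → (∀ w → Adj T y w → w ≡ x) →
    ∀ {z ℓ} → Walk T x z ℓ → z ≡ x ⊎ z ≡ y
  isolated-edge-walk only-y only-x here = inj₁ refl
  isolated-edge-walk only-y only-x (step x~w w⇝z) with only-y _ x~w
  ... | refl with isolated-edge-walk only-x only-y w⇝z
  ...   | inj₁ z≡y = inj₂ z≡y
  ...   | inj₂ z≡x = inj₁ z≡x

  near-neighbours⇒dist≤3 : ∀ {x y p q} → Adj T x p → Adj T y q → Near p q → DistLe T x y 3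
  near-neighbours⇒dist≤3 x~p y~q (inj₁ refl) = 2 , s≤s (s≤s z≤n) , step x~p (step (sym T y~q) here)
  near-neighbours⇒dist≤3 x~p y~q (inj₂ p~q) = 3 , ≤-refl , step x~p (step p~q (step (sym T y~q) here))

  dist≤3⇒near-neighbours : ∀ {x y p q} → (∀ w → Adj T x w → w ≡ p) → (∀ w → Adj T y w → w ≡ q) →
    x ≢ y → ¬ Adj T x y → DistLe T x y 3 → Near p q
  dist≤3⇒near-neighbours only-p only-q x≢y x≁y (_ , _ , here) = ⊥-elim (x≢y refl)
  dist≤3⇒near-neighbours only-p only-q x≢y x≁y (_ , _ , step x~y here) = ⊥-elim (x≁y x~y)
  dist≤3⇒near-neighbours only-p only-q x≢y x≁y (_ , _ , step x~r (step r~y here))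
    with only-p _ x~r | only-q _ (sym T r~y)
  ... | refl | refl = inj₁ refl
  dist≤3⇒near-neighbours only-p only-q x≢y x≁y (_ , _ , step x~r (step r~s (step s~y here)))
    with only-p _ x~r | only-q _ (sym T s~y)
  ... | refl | refl = inj₂ r~s
  dist≤3⇒near-neighbours only-p only-q x≢y x≁y (_ , s≤s (s≤s (s≤s ())) , step _ (step _ (step _ (step _ _))))

pigeonhole-pair : ∀ {A : Set} {u v x y z : A} →
  x ≡ u ⊎ x ≡ v → y ≡ u ⊎ y ≡ v → z ≡ u ⊎ z ≡ v → x ≡ y ⊎ x ≡ z ⊎ y ≡ z
pigeonhole-pair (inj₁ refl) (inj₁ refl) _           = inj₁ refl
pigeonhole-pair (inj₂ refl) (inj₂ refl) _           = inj₁ refl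
pigeonhole-pair (inj₁ refl) (inj₂ refl) (inj₁ refl) = inj₂ (inj₁ refl)
pigeonhole-pair (inj₁ refl) (inj₂ refl) (inj₂ refl) = inj₂ (inj₂ refl)
pigeonhole-pair (inj₂ refl) (inj₁ refl) (inj₁ refl) = inj₂ (inj₂ refl)
pigeonhole-pair (inj₂ refl) (inj₁ refl) (inj₂ refl) = inj₂ (inj₁ refl)

module _ {n : ℕ} {G : Graph n} {m : ℕ} (C : Cycle G m) where

  ChordedQuadruple : Set
  ChordedQuadruple = ∃ λ (a : Fin n) → ∃ λ (b : Fin n) → ∃ λ (c : Fin n) → ∃ λ (d : Fin n) →
    (a ≢ b) × (a ≢ c) × (a ≢ d) × (b ≢ c) × (b ≢ d) × (c ≢ d)
    × CycleStep C a b × CycleStep C c d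
    × Adj G a d × Adj G a c × Adj G b d

  cycleStep⇒adj : ∀ {x y} → CycleStep C x y → Adj G x y
  cycleStep⇒adj (inj₁ (i , refl , refl)) = path C i
  cycleStep⇒adj (inj₂ (refl , refl)) = closing C

  vtx-distinct : ∀ {i j} → i ≢ j → vtx C i ≢ vtx C j
  vtx-distinct i≢j vi≡vj = i≢j (distinct C _ _ vi≡vj)

  vtx-mod : ℕ → Fin n
  vtx-mod k = vtx C (k mod suc m)

  vtx-mod-step : ∀ k → CycleStep C (vtx-mod k) (vtx-mod (suc k))
  vtx-mod-step k with suc-mod m k
  ... | inj₁ (i , k≡i , suc-k≡suc-i) = inj₁ (i , cong (vtx C) k≡i , cong (vtx C) suc-k≡suc-i)
  ... | inj₂ (k≡m , suc-k≡0) = inj₂ (cong (vtx C) k≡m , cong (vtx C) suc-k≡0)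

  vtx-mod-toℕ : ∀ i → vtx-mod (toℕ i) ≡ vtx C i
  vtx-mod-toℕ i = cong (vtx C) (toℕ-injective (trans (toℕ-mod (toℕ i) (suc m)) (m<n⇒m%n≡m (toℕ<n i))))

  vtx-mod-period : ∀ k → vtx-mod (k + suc m) ≡ vtx-mod k
  vtx-mod-period k = cong (vtx C) (toℕ-injective (trans (toℕ-mod (k + suc m) (suc m))
    (trans ([m+n]%n≡m%n k (suc m)) (≡-sym (toℕ-mod k (suc m))))))

  vtx-mod-injective-window : ∀ {k l} → k < l → l < k + suc m → vtx-mod k ≢ vtx-mod l
  vtx-mod-injective-window {k} {l} k<l l<k+N vk≡vl = %-injective-window (suc m) k<l l<k+N
    (trans (≡-sym (toℕ-mod k (suc m))) (trans (cong toℕ (distinct C _ _ vk≡vl)) (toℕ-mod l (suc m))))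

  long-arc : 4 ≤ m → ∀ {B : Set} (f : Fin n → B) {i j : Fin (suc m)} → i Fin.< j →
    f (vtx C i) ≡ f (vtx C j) → ∃₂ λ k l → 3 + k ≤ l × l < k + suc m × f (vtx-mod k) ≡ f (vtx-mod l)
  long-arc 4≤m f {i} {j} i<j fi≡fj with 3 + toℕ i ≤? toℕ j
  ... | yes 3+i≤j = toℕ i , toℕ j , 3+i≤j , <-≤-trans (toℕ<n j) (m≤n+m (suc m) (toℕ i))
      , trans (cong f (vtx-mod-toℕ i)) (trans fi≡fj (cong f (≡-sym (vtx-mod-toℕ j))))
  ... | no 3+i≰j = toℕ j , toℕ i + suc m , 3+j≤i+N , +-monoˡ-< (suc m) i<j
      , trans (cong f (vtx-mod-toℕ j))
          (trans (≡-sym fi≡fj) (cong f (≡-sym (trans (vtx-mod-period (toℕ i)) (vtx-mod-toℕ i)))))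
    where
    3+j≤i+N : 3 + toℕ j ≤ toℕ i + suc m
    3+j≤i+N = begin
      3 + toℕ j     ≤⟨ +-monoʳ-≤ 3 (s≤s⁻¹ (≰⇒> 3+i≰j)) ⟩
      5 + toℕ i     ≤⟨ +-monoˡ-≤ (toℕ i) (s≤s 4≤m) ⟩
      suc m + toℕ i ≡⟨ +-comm (suc m) (toℕ i) ⟩
      toℕ i + suc m ∎
      where open ≤-Reasoning

map-cycle : ∀ {n t m} {G : Graph n} {H : Graph t} (C : Cycle G m) (f : Fin n → Fin t) →
  (∀ i j → f (vtx C i) ≡ f (vtx C j) → i ≡ j) →
  (∀ {u v} → Adj G u v → Near H (f u) (f v)) → Cycle H m
map-cycle {G = G} {H} C f f-injective f-near = record
  { vtx      = λ i → f (vtx C i)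
  ; distinct = f-injective
  ; path     = λ i → image-adj (path C i)
  ; closing  = image-adj (closing C)
  }
  where
  -- Collapsing an edge of the cycle would identify two of its vertices, which are adjacent.
  image-adj : ∀ {i j} → Adj G (vtx C i) (vtx C j) → Adj H (f (vtx C i)) (f (vtx C j))
  image-adj {i} {j} vi~vj with f-near vi~vj
  ... | inj₂ fi~fj = fi~fj
  ... | inj₁ fi≡fj = ⊥-elim (irrefl G (subst (Adj G (vtx C i)) (cong (vtx C) (≡-sym (f-injective i j fi≡fj))) vi~vj))

module LeafPower {n t : ℕ} (G : Graph n) (T : Graph t) (ι : Fin n → Fin t)
  (connected : Connected T) (ι-injective : ∀ u v → ι u ≡ ι v → u ≡ v)
  (leaves : ∀ x → IsLeaf T x ⇔ (∃ λ v → ι v ≡ x))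
  (adj⇔dist≤3 : ∀ u v → u ≢ v → (Adj G u v ⇔ DistLe T (ι u) (ι v) 3)) where

  private
    leaf : ∀ u → IsLeaf T (ι u)
    leaf u = Equivalence.from (leaves (ι u)) (u , refl)

  parent : Fin n → Fin t
  parent u = proj₁ (leaf u)

  parent-adj : ∀ u → Adj T (ι u) (parent u)
  parent-adj u = proj₁ (proj₂ (leaf u))

  parent-unique : ∀ u w → Adj T (ι u) w → w ≡ parent u
  parent-unique u = proj₂ (proj₂ (leaf u))

  -- Two adjacent leaves form a whole component of the tree, hence all of it.
  leaves-apart : ∀ {x y z} → x ≢ y → x ≢ z → y ≢ z → ∀ u v → ¬ Adj T (ι u) (ι v)
  leaves-apart {x} {y} {z} x≢y x≢z y≢z u v u~v =
    [ x≢y , [ x≢z , y≢z ] ] (pigeonhole-pair (covered x) (covered y) (covered z))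
    where
    only-v : ∀ w → Adj T (ι u) w → w ≡ ι v
    only-v w u~w = trans (parent-unique u w u~w) (≡-sym (parent-unique u (ι v) u~v))
    only-u : ∀ w → Adj T (ι v) w → w ≡ ι u
    only-u w v~w = trans (parent-unique v w v~w) (≡-sym (parent-unique v (ι u) (sym T u~v)))
    covered : ∀ w → w ≡ u ⊎ w ≡ v
    covered w with isolated-edge-walk T only-v only-u (proj₂ (connected (ι u) (ι w)))
    ... | inj₁ ιw≡ιu = inj₁ (ι-injective w u ιw≡ιu)
    ... | inj₂ ιw≡ιv = inj₂ (ι-injective w v ιw≡ιv)

  near-parents⇒adj : ∀ {u v} → u ≢ v → Near T (parent u) (parent v) → Adj G u v
  near-parents⇒adj {u} {v} u≢v near =
    Equivalence.from (adj⇔dist≤3 u v u≢v) (near-neighbours⇒dist≤3 T (parent-adj u) (parent-adj v) near)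

  adj⇒near-parents : ∀ {u v} → ¬ Adj T (ι u) (ι v) → Adj G u v → Near T (parent u) (parent v)
  adj⇒near-parents {u} {v} apart u~v = dist≤3⇒near-neighbours T (parent-unique u) (parent-unique v)
    (λ ιu≡ιv → u≢v (ι-injective u v ιu≡ιv)) apart (Equivalence.to (adj⇔dist≤3 u v u≢v) u~v)
    where
    u≢v : u ≢ v
    u≢v refl = irrefl G u~v

  chorded-quadruple : ∀ {m} (C : Cycle G m) → (∀ u v → ¬ Adj T (ι u) (ι v)) →
    ∀ k l → 3 + k ≤ l → l < k + suc m → parent (vtx-mod C k) ≡ parent (vtx-mod C l) → ChordedQuadruple C
  chorded-quadruple {m} C apart k (suc l) (s≤s k+1<l) l+1<k+N pa≡pd =
    a , b , c , d , a≢b , a≢c , a≢d , b≢c , b≢d , c≢d , vtx-mod-step C k , vtx-mod-step C l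
    , near-parents⇒adj a≢d (inj₁ pa≡pd)
    , near-parents⇒adj a≢c (subst (λ p → Near T p (parent c)) (≡-sym pa≡pd) (near-sym T (parents-near (vtx-mod-step C l))))
    , near-parents⇒adj b≢d (subst (Near T (parent b)) pa≡pd (near-sym T (parents-near (vtx-mod-step C k))))
    where
    a = vtx-mod C k
    b = vtx-mod C (suc k)
    c = vtx-mod C l
    d = vtx-mod C (suc l)
    parents-near : ∀ {x y} → CycleStep C x y → Near T (parent x) (parent y)
    parents-near x→y = adj⇒near-parents (apart _ _) (cycleStep⇒adj C x→y)
    in-window : ∀ {x y} → k ≤ x → x < y → y ≤ suc l → vtx-mod C x ≢ vtx-mod C y
    in-window k≤x x<y y≤l+1 =
      vtx-mod-injective-window C x<y (≤-<-trans y≤l+1 (<-≤-trans l+1<k+N (+-monoˡ-≤ (suc m) k≤x)))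
    k<k+1 = n<1+n k
    l<l+1 = n<1+n l
    k≤k+1 = n≤1+n k
    k+1≤l = <⇒≤ k+1<l
    a≢b = in-window ≤-refl k<k+1 (≤-trans k+1≤l (n≤1+n l))
    a≢c = in-window ≤-refl (<-trans k<k+1 k+1<l) (n≤1+n l)
    a≢d = in-window ≤-refl (<-trans k<k+1 (<-trans k+1<l l<l+1)) ≤-refl
    b≢c = in-window k≤k+1 k+1<l (n≤1+n l)
    b≢d = in-window k≤k+1 (<-trans k+1<l l<l+1) ≤-refl
    c≢d = in-window (≤-trans k≤k+1 k+1≤l) l<l+1 ≤-refl

lemma3 : {n : ℕ} (G : Graph n) → Is3LeafPower G →
    (m : ℕ) → 4 ≤ m → (C : Cycle G m) →
    ∃ λ (a : Fin n) → ∃ λ (b : Fin n) → ∃ λ (c : Fin n) → ∃ λ (d : Fin n) →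
    (a ≢ b) × (a ≢ c) × (a ≢ d) × (b ≢ c) × (b ≢ d) × (c ≢ d)
    × CycleStep C a b × CycleStep C c d
    × Adj G a d × Adj G a c × Adj G b d
lemma3 G (t , T , ι , (connected , acyclic) , ι-injective , leaves , adj⇔dist≤3) m 4≤m@(s≤s (s≤s _)) C =
  conclude (injective⊎collision _≟ᶠ_ (λ i → parent (vtx C i)))
  where
  open LeafPower G T ι connected ι-injective leaves adj⇔dist≤3
  apart : ∀ u v → ¬ Adj T (ι u) (ι v)
  apart = leaves-apart (vtx-distinct C {zero} {suc zero} (λ ()))
    (vtx-distinct C {zero} {suc (suc zero)} (λ ())) (vtx-distinct C {suc zero} {suc (suc zero)} (λ ()))
  conclude : (∀ i j → parent (vtx C i) ≡ parent (vtx C j) → i ≡ j)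
    ⊎ ∃₂ (λ i j → i Fin.< j × parent (vtx C i) ≡ parent (vtx C j)) → ChordedQuadruple C
  conclude (inj₁ injective) =
    ⊥-elim (acyclic m (s≤s (s≤s z≤n)) (map-cycle C parent injective (adj⇒near-parents (apart _ _))))
  conclude (inj₂ (i , j , i<j , pi≡pj)) with long-arc C 4≤m parent i<j pi≡pj
  ... | k , l , 3+k≤l , l<k+N , pk≡pl = chorded-quadruple C apart k l 3+k≤l l<k+N pk≡pl
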